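{- Let $G$ be a finite abelian group with $r(G)\geq 2$ that is not isomorphic to $C_2\oplus C_{2m}$ for any positive integer $m$. Let $S=T\cdot g^2$ be a sequence over $G$ of length $\mathsf{D}(G)+1$, where $g\in G$ and $T$ is a zero-sum sequence of length $\mathsf{D}(G)-1$. Then $S$ has a nonempty zero-sum subsequence of length at most $\mathsf{D}(G)-2$.
   Context: Groups are finite abelian, written additively; $r(G)$ is the rank. A sequence over $G$ is a finite unordered sequence (multiset) of elements of $G$; length counts multiplicity; $T\cdot g^2$ is $T$ with two additional copies of $g$; zero-sum means the terms sum to $0$. $\mathsf{D}(G)$ is the smallest $t$ such that every sequence over $G$ of length at least $t$ has a nonempty zero-sum subsequence. -}

module Defs where

open import Level using (Level; _⊔_)
open import Algebra.Bundles using (AbelianGroup)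
open import Data.Nat using (ℕ; zero; suc; _+_; _*_; _<_; _≤_)
open import Data.Nat.DivMod using (_%_)
open import Data.Nat.Divisibility using (_∣_)
open import Data.Fin using (Fin; toℕ) renaming (zero to fz; suc to fs)
open import Data.Vec using (Vec; []; _∷_; lookup)
open import Data.List using (List; []; _∷_; foldr; length)
open import Data.List.Relation.Unary.Any using (Any)
open import Data.List.Relation.Binary.Sublist.Propositional using (_⊆_)
open import Data.Product using (Σ; ∃; _×_)
open import Relation.Binary.PropositionalEquality using (_≡_)

-- Addition in the cyclic group C_n = ℤ/nℤ, realised on representatives 0..n-1.
-- (The case n = 0 never occurs for the groups used below, since Fin 0 is empty.)
addMod : ℕ → ℕ → ℕ → ℕ
addMod zero    a b = a + b
addMod (suc n) a b = (a + b) % suc n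

CycSum : ∀ {r} → Vec ℕ r → Set
CycSum {r} ns = (i : Fin r) → Fin (lookup ns i)

module _ {c ℓ : Level} (G : AbelianGroup c ℓ) where
  open AbelianGroup G

  IsFinite : Set (c ⊔ ℓ)
  IsFinite = Σ (List Carrier) λ xs → ∀ x → Any (x ≈_) xs

  record IsoCycSum {r : ℕ} (ns : Vec ℕ r) : Set (c ⊔ ℓ) where
    field
      φ          : Carrier → CycSum ns
      φ-cong     : ∀ {x y} → x ≈ y → ∀ i → φ x i ≡ φ y i
      φ-hom      : ∀ x y i → toℕ (φ (x ∙ y) i)
                               ≡ addMod (lookup ns i) (toℕ (φ x i)) (toℕ (φ y i))
      φ-injective : ∀ {x y} → (∀ i → φ x i ≡ φ y i) → x ≈ y
      φ-surjective : ∀ (v : CycSum ns) → Σ Carrier λ x → ∀ i → φ x i ≡ v i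

  data Chain : ∀ {r} → Vec ℕ r → Set where
    nil  : Chain []
    one  : ∀ {n} → 1 < n → Chain (n ∷ [])
    cons : ∀ {r n m} {ns : Vec ℕ r} → 1 < n → n ∣ m → Chain (m ∷ ns) → Chain (n ∷ m ∷ ns)

  -- G ≅ C_{n_1} ⊕ ... ⊕ C_{n_r} with 1 < n_1 | ... | n_r; then r(G) = r.
  InvariantFactors : ∀ {r} → Vec ℕ r → Set (c ⊔ ℓ)
  InvariantFactors ns = Chain ns × IsoCycSum ns

  HasRank : ℕ → Set (c ⊔ ℓ)
  HasRank r = Σ (Vec ℕ r) InvariantFactors

  IsoC2C2m : ℕ → Set (c ⊔ ℓ)
  IsoC2C2m m = IsoCycSum (2 ∷ 2 * m ∷ [])

  -- Sequences over G are lists (order is irrelevant for everything below).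
  σ : List Carrier → Carrier
  σ = foldr _∙_ ε

  ZeroSum : List Carrier → Set ℓ
  ZeroSum xs = σ xs ≈ ε

  HasNZSS : List Carrier → Set (c ⊔ ℓ)
  HasNZSS S = Σ (List Carrier) λ U → U ⊆ S × 1 ≤ length U × ZeroSum U

  DavenportBound : ℕ → Set (c ⊔ ℓ)
  DavenportBound t = ∀ (S : List Carrier) → t ≤ length S → HasNZSS S

  IsDavenport : ℕ → Set (c ⊔ ℓ)
  IsDavenport d = DavenportBound d × (∀ t → DavenportBound t → d ≤ t)

{-# OPTIONS --safe #-}
module Submission where

-- Let e = n_r be the exponent of G ≅ C_{n_1} ⊕ … ⊕ C_{n_r}. Since r ≥ 2 and G ≇ C₂ ⊕ C₂ₘ, one of
-- e_r^{e-1} e_1 e_1 (if n_1 ≥ 3) or e_r^{e-1} e_1 e_2 (if n_1 = 2, so r ≥ 3) is zero-sum free,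
-- hence e + 2 ≤ D(G).
-- Then a descent on T. If a term t of T is neither g nor 2g, the sequence g g (T minus t) has
-- length D(G), so it has a nonempty zero-sum subsequence. Either that subsequence is short, or
-- it omits exactly one term y of T, and comparing sums with σ(T) = 0 gives t + y = 2g, y ≠ g.
-- Replacing t, y by g, g gives a zero-sum T′ of the same length with fewer terms different
-- from g, and a short zero-sum subsequence of g g T′ becomes one of g g T by trading two of
-- its g's back for t, y. Once every term is g or 2g, some subsequence of g T sums to e·g = 0
-- and has length between 1 and e ≤ D(G) - 2.

open import Defs
open import Level using (Level; _⊔_)
open import Function using (_∘_)
open import Algebra.Bundles using (AbelianGroup)
open import Data.Bool using (true; false; if_then_else_)
open import Data.Empty using (⊥-elim)
open import Data.Nat using (ℕ; zero; suc; pred; _+_; _*_; _≤_; _<_; z≤n; s≤s; _≤?_; NonZero; >-nonZero)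
open import Data.Nat.Properties
  using (≤-refl; ≤-trans; ≤-reflexive; ≤-antisym; ≤-pred; <⇒≤; ≰⇒>; m≤m+n; m≤n+m; m≤n⇒m≤1+n;
         n<1+n; m<n⇒m<1+n; +-comm; +-assoc; +-identityʳ; *-identityʳ; *-zeroʳ; *-comm;
         +-monoˡ-≤; +-monoʳ-≤; suc-pred; module ≤-Reasoning)
open import Data.Nat.DivMod using (_%_; m<n⇒m%n≡m; %-distribˡ-+; m%n%n≡m%n)
open import Data.Nat.Divisibility using (_∣_; divides; ∣-refl; ∣-trans; ∣m⇒∣m*n; n∣m⇒m%n≡0)
open import Data.Nat.ListAction using (sum)
open import Data.Nat.Induction using (<-wellFounded)
open import Induction.WellFounded using (Acc; acc)
open import Data.Fin using (Fin; toℕ; fromℕ; fromℕ<) renaming (zero to fz; suc to fs)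
open import Data.Fin.Properties using (toℕ-fromℕ<; toℕ-injective) renaming (_≟_ to _≟ᶠ_)
import Data.Fin.Properties as Fin
open import Data.Vec using (Vec; []; _∷_; lookup)
open import Data.List using (List; []; _∷_; _++_; [_]; length; map; replicate; filter)
open import Data.List.Properties using (length-++; length-replicate; filter-accept; filter-reject)
open import Data.List.Relation.Unary.All using (All; []; _∷_; all?)
open import Data.List.Relation.Unary.All.Properties using (¬All⇒Any¬; ++⁺; replicate⁺)
open import Data.List.Relation.Unary.Any using (Any; here; there)
open import Data.List.Relation.Binary.Sublist.Propositional
  using (_⊆_; []; _∷_; _∷ʳ_; minimum; ⊆-refl; ⊆-trans)
open import Data.List.Relation.Binary.Sublist.Propositional.Properties
  using (All-resp-⊆; to-≋; length-mono-≤) renaming (map⁺ to ⊆-map⁺; ++⁺ to ⊆-++⁺)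
open import Data.List.Relation.Binary.Equality.Propositional using (≋⇒≡)
open import Data.List.Relation.Binary.Permutation.Propositional
  using (_↭_; refl; prep; swap; trans; ↭-sym; ↭-trans; ↭⇒↭ₛ′)
open import Data.List.Relation.Binary.Permutation.Propositional.Properties
  using (↭-length; shift; shifts; ∷↭∷ʳ; filter-↭)
open import Data.Product using (Σ; _×_; _,_; proj₁; proj₂; ∃; ∃₂)
open import Data.Sum using (_⊎_; inj₁; inj₂)
open import Relation.Nullary using (¬_; Dec; yes; no; does)
open import Relation.Nullary.Decidable using (map′; _⊎-dec_; ¬?; dec-true; dec-false)
open import Relation.Nullary.Negation using (contradiction)
open import Relation.Binary.Definitions using (Decidable)
open import Relation.Binary.PropositionalEquality
  using (_≡_; _≢_; cong; cong₂; subst; ≢-sym; module ≡-Reasoning)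
  renaming (refl to ≡-refl; sym to ≡-sym; trans to ≡-trans)

private
  variable
    a : Level
    A : Set a
    x : A
    xs ys us : List A
    k l : ℕ

sum-mono-⊆ : {ms ns : List ℕ} → ms ⊆ ns → sum ms ≤ sum ns
sum-mono-⊆ []               = z≤n
sum-mono-⊆ (n ∷ʳ ms⊆ns)     = ≤-trans (sum-mono-⊆ ms⊆ns) (m≤n+m _ n)
sum-mono-⊆ (≡-refl ∷ ms⊆ns) = +-monoʳ-≤ _ (sum-mono-⊆ ms⊆ns)

⊆-along-↭ : us ⊆ xs → xs ↭ ys → ∃ λ vs → us ↭ vs × vs ⊆ ys
⊆-along-↭ p refl = _ , refl , p
⊆-along-↭ (x ∷ʳ p) (prep x q) with vs , r , p′ ← ⊆-along-↭ p q = vs , r , x ∷ʳ p′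
⊆-along-↭ (≡-refl ∷ p) (prep x q) with vs , r , p′ ← ⊆-along-↭ p q =
  x ∷ vs , prep x r , ≡-refl ∷ p′
⊆-along-↭ (x ∷ʳ y ∷ʳ p) (swap x y q) with vs , r , p′ ← ⊆-along-↭ p q =
  vs , r , y ∷ʳ x ∷ʳ p′
⊆-along-↭ (x ∷ʳ ≡-refl ∷ p) (swap x y q) with vs , r , p′ ← ⊆-along-↭ p q =
  y ∷ vs , prep y r , ≡-refl ∷ x ∷ʳ p′
⊆-along-↭ (≡-refl ∷ y ∷ʳ p) (swap x y q) with vs , r , p′ ← ⊆-along-↭ p q =
  x ∷ vs , prep x r , y ∷ʳ ≡-refl ∷ p′
⊆-along-↭ (≡-refl ∷ ≡-refl ∷ p) (swap x y q) with vs , r , p′ ← ⊆-along-↭ p q =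
  y ∷ x ∷ vs , swap x y r , ≡-refl ∷ ≡-refl ∷ p′
⊆-along-↭ p (trans q₁ q₂) =
  let vs₁ , r₁ , p₁ = ⊆-along-↭ p q₁
      vs₂ , r₂ , p₂ = ⊆-along-↭ p₁ q₂
  in vs₂ , trans r₁ r₂ , p₂

⊆-full-or-one-less : us ⊆ xs → length xs ≤ suc (length us) →
                     us ≡ xs ⊎ ∃₂ λ ps y → ∃ λ qs → xs ≡ ps ++ y ∷ qs × us ≡ ps ++ qs
⊆-full-or-one-less []       _ = inj₁ ≡-refl
⊆-full-or-one-less (y ∷ʳ p) (s≤s |xs|≤|us|) =
  inj₂ ([] , y , _ , ≡-refl , ≋⇒≡ (to-≋ (≤-antisym (length-mono-≤ p) |xs|≤|us|) p))
⊆-full-or-one-less (≡-refl ∷ p) (s≤s |xs|≤1+|us|) with ⊆-full-or-one-less p |xs|≤1+|us|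
... | inj₁ ≡-refl = inj₁ ≡-refl
... | inj₂ (ps , y , qs , ≡-refl , ≡-refl) = inj₂ (_ ∷ ps , y , qs , ≡-refl , ≡-refl)

replicate-⊆ : k ≤ l → replicate k x ⊆ replicate l x
replicate-⊆ {l = l} z≤n = minimum (replicate l _)
replicate-⊆ (s≤s k≤l) = ≡-refl ∷ replicate-⊆ k≤l

⊆-replicate-++⁻ : ∀ n → us ⊆ replicate n x ++ xs →
                  ∃₂ λ m vs → m ≤ n × vs ⊆ xs × us ≡ replicate m x ++ vs
⊆-replicate-++⁻ zero p = 0 , _ , z≤n , p , ≡-refl
⊆-replicate-++⁻ (suc n) (_ ∷ʳ p) with m , vs , m≤n , vs⊆xs , ≡-refl ← ⊆-replicate-++⁻ n p =
  m , vs , m≤n⇒m≤1+n m≤n , vs⊆xs , ≡-refl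
⊆-replicate-++⁻ (suc n) (≡-refl ∷ p) with m , vs , m≤n , vs⊆xs , ≡-refl ← ⊆-replicate-++⁻ n p =
  suc m , vs , s≤s m≤n , vs⊆xs , ≡-refl

Any-extract : ∀ {p} {P : A → Set p} → Any P xs → ∃₂ λ y ys → P y × xs ↭ y ∷ ys
Any-extract (here py) = _ , _ , py , refl
Any-extract (there {x = x} any) with y , ys , py , xs↭ ← Any-extract any =
  y , x ∷ ys , py , trans (prep x xs↭) (swap x y refl)

module ShortZeroSums {c ℓ : Level} (G : AbelianGroup c ℓ) where
  open AbelianGroup G renaming (Carrier to C; refl to ≈-refl; sym to ≈-sym; trans to ≈-trans)
  open import Algebra.Properties.Group group using (∙-cancelʳ)
  open import Algebra.Definitions.RawMonoid rawMonoid using () renaming (_×_ to _·_)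
  open import Data.List.Relation.Binary.Permutation.Setoid.Properties setoid
    using (foldr-commMonoid)

  private
    variable
      d : ℕ
      R S S′ : List C

  σ-↭ : S ↭ S′ → σ G S ≈ σ G S′
  σ-↭ = foldr-commMonoid isCommutativeMonoid ∘ ↭⇒↭ₛ′ isEquivalence

  ∙-cancelʳ-ε : ∀ {x y s} → x ∙ s ≈ ε → y ∙ s ≈ ε → x ≈ y
  ∙-cancelʳ-ε {x} {y} {s} x∙s≈ε y∙s≈ε = ∙-cancelʳ s x y (≈-trans x∙s≈ε (≈-sym y∙s≈ε))

  ∙-pair-cong : ∀ {x y u v s} → x ∙ y ≈ u ∙ v → x ∙ (y ∙ s) ≈ u ∙ (v ∙ s)
  ∙-pair-cong {x} {y} {u} {v} {s} x∙y≈u∙v =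
    ≈-trans (≈-sym (assoc x y s)) (≈-trans (∙-congʳ x∙y≈u∙v) (assoc u v s))

  ShortZeroSum : ℕ → List C → Set _
  ShortZeroSum d S = Σ (List C) λ U → U ⊆ S × 1 ≤ length U × length U + 2 ≤ d × ZeroSum G U

  short-⊆ : S ⊆ S′ → ShortZeroSum d S → ShortZeroSum d S′
  short-⊆ S⊆S′ (U , U⊆S , short) = U , ⊆-trans U⊆S S⊆S′ , short

  short-↭ : S ↭ S′ → ShortZeroSum d S → ShortZeroSum d S′
  short-↭ {d = d} S↭S′ (U , U⊆S , 1≤|U| , |U|+2≤d , σU≈ε)
    with V , U↭V , V⊆S′ ← ⊆-along-↭ U⊆S S↭S′ =
    V , V⊆S′ , subst (1 ≤_) (↭-length U↭V) 1≤|U| ,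
    subst (λ l → l + 2 ≤ d) (↭-length U↭V) |U|+2≤d , ≈-trans (≈-sym (σ-↭ U↭V)) σU≈ε

  module _ (g : C) where

    -- A subsequence using at most two of the four g's fits around t, y; one using three or
    -- four of them trades two for t, y.
    short-exchange : ∀ {t y} → t ∙ y ≈ g ∙ g →
                     ShortZeroSum d (g ∷ g ∷ g ∷ g ∷ R) → ShortZeroSum d (t ∷ y ∷ g ∷ g ∷ R)
    short-exchange {t = t} {y} t∙y≈g∙g (U , U⊆ , short) with ⊆-replicate-++⁻ 4 U⊆
    ... | 0 , _ , _ , vs⊆R , ≡-refl = U , t ∷ʳ y ∷ʳ g ∷ʳ g ∷ʳ vs⊆R , short
    ... | 1 , _ , _ , vs⊆R , ≡-refl = U , t ∷ʳ y ∷ʳ ≡-refl ∷ g ∷ʳ vs⊆R , short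
    ... | suc (suc k) , vs , s≤s (s≤s k≤2) , vs⊆R , ≡-refl
      with 1≤|U| , |U|+2≤d , σU≈ε ← short =
      t ∷ y ∷ replicate k g ++ vs , ≡-refl ∷ ≡-refl ∷ ⊆-++⁺ (replicate-⊆ k≤2) vs⊆R ,
      1≤|U| , |U|+2≤d , ≈-trans (∙-pair-cong t∙y≈g∙g) σU≈ε

    OneOrTwoG : C → Set ℓ
    OneOrTwoG x = x ≈ g ⊎ x ≈ g ∙ g

    -- The extra g sits at the end of S so that the recursion on S extends U at its head.
    multiple-⊆ : All OneOrTwoG S → ∀ k → k ≤ length S →
                 ∃ λ U → U ⊆ S ++ [ g ] × σ G U ≈ suc k · g × 1 ≤ length U × length U ≤ suc k
    multiple-⊆ [] zero z≤n = [ g ] , ⊆-refl , ≈-refl , ≤-refl , ≤-refl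
    multiple-⊆ {x ∷ _} (inj₁ x≈g ∷ _) zero _ =
      [ x ] , ≡-refl ∷ minimum _ , ∙-congʳ x≈g , ≤-refl , ≤-refl
    multiple-⊆ {x ∷ _} (inj₁ x≈g ∷ gs) (suc k) (s≤s k≤|S|)
      with U , U⊆ , σU≈ , _ , |U|≤ ← multiple-⊆ gs k k≤|S| =
      x ∷ U , ≡-refl ∷ U⊆ , ∙-cong x≈g σU≈ , s≤s z≤n , s≤s |U|≤
    multiple-⊆ {x ∷ _} (inj₂ _ ∷ gs) zero _
      with U , U⊆ , bounds ← multiple-⊆ gs zero z≤n = U , x ∷ʳ U⊆ , bounds
    multiple-⊆ {x ∷ _} (inj₂ x≈2g ∷ _) (suc zero) _ =
      [ x ] , ≡-refl ∷ minimum _ , ≈-trans (∙-congʳ x≈2g) (assoc g g ε) , ≤-refl , s≤s z≤n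
    multiple-⊆ {x ∷ _} (inj₂ x≈2g ∷ gs) (suc (suc k)) (s≤s 1+k≤|S|)
      with U , U⊆ , σU≈ , _ , |U|≤ ← multiple-⊆ gs k (<⇒≤ 1+k≤|S|) =
      x ∷ U , ≡-refl ∷ U⊆ , ≈-trans (∙-cong x≈2g σU≈) (assoc g g _) ,
      s≤s z≤n , s≤s (m≤n⇒m≤1+n |U|≤)

    short-from-multiples : All OneOrTwoG S → ∀ {e} → 1 ≤ e → e + 2 ≤ d → e · g ≈ ε →
                           suc (length S) ≡ d → ShortZeroSum d (g ∷ g ∷ S)
    short-from-multiples {S} gs {suc e} _ 1+e+2≤d e·g≈ε ≡-refl
      with U , U⊆ , σU≈ , 1≤|U| , |U|≤ ← multiple-⊆ gs e (≤-trans (m≤m+n e 2) (≤-pred 1+e+2≤d)) =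
      short-⊆ (g ∷ʳ ⊆-refl) (short-↭ (↭-sym (∷↭∷ʳ g S))
        (U , U⊆ , 1≤|U| , ≤-trans (+-monoˡ-≤ 2 |U|≤) 1+e+2≤d , ≈-trans σU≈ e·g≈ε))

    -- A zero-sum subsequence of g g R that is not short misses at most one of its terms, and
    -- σ (t ∷ R) ≈ ε forces that term to be some y ∈ R with t ∙ y ≈ g ∙ g.
    pair-or-short : ∀ {t} → DavenportBound G d → ZeroSum G (t ∷ R) → suc (length (t ∷ R)) ≡ d →
                    ¬ t ≈ g → ¬ t ≈ g ∙ g →
                    ShortZeroSum d (g ∷ g ∷ R) ⊎ ∃₂ λ y R₁ → t ∙ y ≈ g ∙ g × ¬ y ≈ g × R ↭ y ∷ R₁
    pair-or-short {R = R} {t} dav σtR≈ε ≡-refl t≉g t≉2g with dav (g ∷ g ∷ R) ≤-refl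
    ... | V , V⊆ , 1≤|V| , σV≈ε with length V + 2 ≤? length (g ∷ g ∷ R)
    ...   | yes short = inj₁ (V , V⊆ , 1≤|V| , short , σV≈ε)
    ...   | no long
      with ⊆-full-or-one-less V⊆ (≤-pred (≤-trans (≰⇒> long) (≤-reflexive (+-comm (length V) 2))))
    ...     | inj₁ ≡-refl = ⊥-elim (t≉2g (∙-cancelʳ-ε σtR≈ε (≈-trans (assoc g g _) σV≈ε)))
    ...     | inj₂ ([] , _ , _ , ≡-refl , ≡-refl) = ⊥-elim (t≉g (∙-cancelʳ-ε σtR≈ε σV≈ε))
    ...     | inj₂ (_ ∷ [] , _ , _ , ≡-refl , ≡-refl) = ⊥-elim (t≉g (∙-cancelʳ-ε σtR≈ε σV≈ε))
    ...     | inj₂ (_ ∷ _ ∷ ps , y , qs , ≡-refl , ≡-refl) =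
      inj₂ (y , ps ++ qs , t∙y≈g∙g , y≉g , shift y ps qs)
      where
      σt∷y∷ps++qs≈ε : σ G (t ∷ y ∷ ps ++ qs) ≈ ε
      σt∷y∷ps++qs≈ε = ≈-trans (∙-congˡ (≈-sym (σ-↭ (shift y ps qs)))) σtR≈ε
      t∙y≈g∙g : t ∙ y ≈ g ∙ g
      t∙y≈g∙g = ∙-cancelʳ-ε (≈-trans (assoc t y _) σt∷y∷ps++qs≈ε) (≈-trans (assoc g g _) σV≈ε)
      y≉g : ¬ y ≈ g
      y≉g y≈g = t≉g (∙-cancelʳ-ε (≈-trans (∙-congˡ (∙-congʳ (≈-sym y≈g))) σt∷y∷ps++qs≈ε) σV≈ε)

    module _ (_≈?_ : Decidable _≈_) where

      oneOrTwoG? : ∀ x → Dec (OneOrTwoG x)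
      oneOrTwoG? x = (x ≈? g) ⊎-dec (x ≈? (g ∙ g))

      ≉g? : ∀ x → Dec (¬ x ≈ g)
      ≉g? x = ¬? (x ≈? g)

      count≉g : List C → ℕ
      count≉g = length ∘ filter ≉g?

      count≉g-↭ : S ↭ S′ → count≉g S ≡ count≉g S′
      count≉g-↭ = ↭-length ∘ filter-↭ ≉g?

      count≉g-g : count≉g (g ∷ S) ≡ count≉g S
      count≉g-g = cong length (filter-reject ≉g? (λ g≉g → g≉g ≈-refl))

      count≉g-≉ : ∀ {x} → ¬ x ≈ g → count≉g (x ∷ S) ≡ suc (count≉g S)
      count≉g-≉ x≉g = cong length (filter-accept ≉g? x≉g)

      record Reduction (S : List C) : Set (c ⊔ ℓ) where
        field
          t y     : C
          rest    : List C
          t∙y≈g∙g : t ∙ y ≈ g ∙ g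
          t≉g     : ¬ t ≈ g
          y≉g     : ¬ y ≈ g
          S↭      : S ↭ t ∷ y ∷ rest

        reduct : List C
        reduct = g ∷ g ∷ rest

        σ-reduct : σ G S ≈ σ G reduct
        σ-reduct = ≈-trans (σ-↭ S↭) (∙-pair-cong t∙y≈g∙g)

        length-reduct : length S ≡ length reduct
        length-reduct = ↭-length S↭

        count≉g-reduct : count≉g reduct < count≉g S
        count≉g-reduct = begin-strict
          count≉g (g ∷ g ∷ rest)       ≡⟨ ≡-trans count≉g-g count≉g-g ⟩
          count≉g rest                 <⟨ m<n⇒m<1+n (n<1+n _) ⟩
          suc (suc (count≉g rest))     ≡⟨ ≡-trans (count≉g-≉ t≉g) (cong suc (count≉g-≉ y≉g)) ⟨
          count≉g (t ∷ y ∷ rest)       ≡⟨ count≉g-↭ S↭ ⟨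
          count≉g S                    ∎
          where open ≤-Reasoning

        short-reduct : ShortZeroSum d (g ∷ g ∷ reduct) → ShortZeroSum d (g ∷ g ∷ S)
        short-reduct =
          short-↭ (↭-trans (shifts (t ∷ y ∷ []) (g ∷ g ∷ [])) (prep g (prep g (↭-sym S↭))))
          ∘ short-exchange t∙y≈g∙g

      reduction-or-short : DavenportBound G d → ZeroSum G S → suc (length S) ≡ d →
                           ¬ All OneOrTwoG S → ShortZeroSum d (g ∷ g ∷ S) ⊎ Reduction S
      reduction-or-short dav σS≈ε |S|+1≡d ¬gs with Any-extract (¬All⇒Any¬ oneOrTwoG? _ ¬gs)
      ... | t , R , ¬t∈ , S↭t∷R
        with pair-or-short dav (≈-trans (≈-sym (σ-↭ S↭t∷R)) σS≈ε)
               (≡-trans (cong suc (≡-sym (↭-length S↭t∷R))) |S|+1≡d) (¬t∈ ∘ inj₁) (¬t∈ ∘ inj₂)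
      ...   | inj₁ short =
        inj₁ (short-↭ (prep g (prep g (↭-sym S↭t∷R))) (short-⊆ (≡-refl ∷ ≡-refl ∷ t ∷ʳ ⊆-refl) short))
      ...   | inj₂ (y , R₁ , t∙y≈g∙g , y≉g , R↭y∷R₁) = inj₂ (record
        { t∙y≈g∙g = t∙y≈g∙g ; t≉g = ¬t∈ ∘ inj₁ ; y≉g = y≉g ; S↭ = ↭-trans S↭t∷R (prep t R↭y∷R₁) })

      short-zero-sum : DavenportBound G d → ∀ {e} → 1 ≤ e → e + 2 ≤ d → e · g ≈ ε →
                       ZeroSum G S → suc (length S) ≡ d → ShortZeroSum d (g ∷ g ∷ S)
      short-zero-sum {d} {S} dav 1≤e e+2≤d e·g≈ε = go S (<-wellFounded (count≉g S))
        where
        go : ∀ S → Acc _<_ (count≉g S) → ZeroSum G S → suc (length S) ≡ d → ShortZeroSum d (g ∷ g ∷ S)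
        go S (acc smaller) σS≈ε |S|+1≡d with all? oneOrTwoG? S
        ... | yes gs = short-from-multiples gs 1≤e e+2≤d e·g≈ε |S|+1≡d
        ... | no ¬gs with reduction-or-short dav σS≈ε |S|+1≡d ¬gs
        ...   | inj₁ short = short
        ...   | inj₂ r = short-reduct (go reduct (smaller count≉g-reduct)
                                           (≈-trans (≈-sym σ-reduct) σS≈ε)
                                           (≡-trans (cong suc (≡-sym length-reduct)) |S|+1≡d))
          where open Reduction r

zeroSumFree⇒length<D : ∀ {c ℓ} (G : AbelianGroup c ℓ) {d} {S : List (AbelianGroup.Carrier G)} →
                       DavenportBound G d → ¬ HasNZSS G S → length S < d
zeroSumFree⇒length<D G {d} {S} dav zsf with d ≤? length S
... | yes d≤|S| = contradiction (dav S d≤|S|) zsf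
... | no d≰|S| = ≰⇒> d≰|S|

addMod≡% : ∀ n .{{_ : NonZero n}} a b → addMod n a b ≡ (a + b) % n
addMod≡% (suc n) a b = ≡-refl

module Coordinates {c ℓ : Level} (G : AbelianGroup c ℓ) {r : ℕ} {ns : Vec ℕ r}
                   (iso : IsoCycSum G ns) (1<n : ∀ i → 1 < lookup ns i) where
  open AbelianGroup G renaming (Carrier to C; refl to ≈-refl; sym to ≈-sym; trans to ≈-trans)
  open IsoCycSum iso
  open import Algebra.Properties.Group group using (identityˡ-unique)
  open import Algebra.Definitions.RawMonoid rawMonoid using () renaming (_×_ to _·_)

  n : Fin r → ℕ
  n = lookup ns

  0<n : ∀ i → 0 < n i
  0<n i = <⇒≤ (1<n i)

  instance
    n-nonZero : ∀ {i} → NonZero (n i)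
    n-nonZero {i} = >-nonZero (0<n i)

  coord : Fin r → C → ℕ
  coord i x = toℕ (φ x i)

  coordSum : Fin r → List C → ℕ
  coordSum i = sum ∘ map (coord i)

  coord-∙ : ∀ i x y → coord i (x ∙ y) ≡ (coord i x + coord i y) % n i
  coord-∙ i x y = ≡-trans (φ-hom x y i) (addMod≡% (n i) _ _)

  coord-injective : ∀ {x y} → (∀ i → coord i x ≡ coord i y) → x ≈ y
  coord-injective eq = φ-injective (λ i → toℕ-injective (eq i))

  _≈?_ : Decidable _≈_
  x ≈? y = map′ φ-injective (λ x≈y → φ-cong x≈y) (Fin.all? (λ i → φ x i ≟ᶠ φ y i))

  fromCoords : (v : Fin r → ℕ) → (∀ i → v i < n i) → C
  fromCoords v v<n = proj₁ (φ-surjective (λ i → fromℕ< (v<n i)))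

  coord-fromCoords : ∀ v v<n i → coord i (fromCoords v v<n) ≡ v i
  coord-fromCoords v v<n i =
    ≡-trans (cong toℕ (proj₂ (φ-surjective (λ i → fromℕ< (v<n i))) i)) (toℕ-fromℕ< (v<n i))

  coord-ε : ∀ i → coord i ε ≡ 0
  coord-ε i = ≡-trans (cong toℕ (φ-cong (≈-sym origin≈ε) i)) (coord-origin i)
    where
    open ≡-Reasoning
    origin : C
    origin = fromCoords (λ _ → 0) 0<n
    coord-origin : ∀ i → coord i origin ≡ 0
    coord-origin = coord-fromCoords (λ _ → 0) 0<n
    origin≈ε : origin ≈ ε
    origin≈ε = identityˡ-unique origin origin (coord-injective λ i → begin
      coord i (origin ∙ origin)                   ≡⟨ coord-∙ i origin origin ⟩
      (coord i origin + coord i origin) % n i     ≡⟨ cong₂ (λ a b → (a + b) % n i)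
                                                           (coord-origin i) (coord-origin i) ⟩
      0 % n i                                     ≡⟨ m<n⇒m%n≡m (0<n i) ⟩
      0                                           ≡⟨ coord-origin i ⟨
      coord i origin                              ∎)

  coord-σ : ∀ i xs → coordSum i xs < n i → coord i (σ G xs) ≡ coordSum i xs
  coord-σ i [] _ = coord-ε i
  coord-σ i (x ∷ xs) sum<n = begin
    coord i (x ∙ σ G xs)                    ≡⟨ coord-∙ i x _ ⟩
    (coord i x + coord i (σ G xs)) % n i    ≡⟨ cong (λ s → (coord i x + s) % n i)
                                                   (coord-σ i xs sum′<n) ⟩
    coordSum i (x ∷ xs) % n i               ≡⟨ m<n⇒m%n≡m sum<n ⟩
    coordSum i (x ∷ xs)                     ∎
    where
    open ≡-Reasoning
    sum′<n : coordSum i xs < n i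
    sum′<n = ≤-trans (s≤s (m≤n+m _ (coord i x))) sum<n

  coord-· : ∀ i k x → coord i (k · x) ≡ (k * coord i x) % n i
  coord-· i zero x = ≡-trans (coord-ε i) (≡-sym (m<n⇒m%n≡m (0<n i)))
  coord-· i (suc k) x = begin
    coord i (x ∙ k · x)                           ≡⟨ coord-∙ i x (k · x) ⟩
    (cx + coord i (k · x)) % n i                  ≡⟨ cong (λ s → (cx + s) % n i) (coord-· i k x) ⟩
    (cx + (k * cx) % n i) % n i                   ≡⟨ %-distribˡ-+ cx _ (n i) ⟩
    (cx % n i + (k * cx) % n i % n i) % n i       ≡⟨ cong (λ s → (cx % n i + s) % n i)
                                                         (m%n%n≡m%n (k * cx) (n i)) ⟩
    (cx % n i + (k * cx) % n i) % n i             ≡⟨ %-distribˡ-+ cx (k * cx) (n i) ⟨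
    (cx + k * cx) % n i                           ∎
    where
    open ≡-Reasoning
    cx : ℕ
    cx = coord i x

  ·-annihilates : ∀ {k} → (∀ i → n i ∣ k) → ∀ x → k · x ≈ ε
  ·-annihilates {k} n∣k x = coord-injective λ i → begin
    coord i (k · x)             ≡⟨ coord-· i k x ⟩
    (k * coord i x) % n i       ≡⟨ n∣m⇒m%n≡0 _ (n i) (∣m⇒∣m*n (coord i x) (n∣k i)) ⟩
    0                           ≡⟨ coord-ε i ⟨
    coord i ε                   ∎
    where open ≡-Reasoning

  δ : Fin r → Fin r → ℕ
  δ j i = if does (i ≟ᶠ j) then 1 else 0

  δ<n : ∀ j i → δ j i < n i
  δ<n j i with does (i ≟ᶠ j)
  ... | true  = 1<n i
  ... | false = 0<n i

  unit : Fin r → C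
  unit j = fromCoords (δ j) (δ<n j)

  coord-unit-≡ : ∀ i → coord i (unit i) ≡ 1
  coord-unit-≡ i =
    ≡-trans (coord-fromCoords (δ i) (δ<n i) i)
            (cong (if_then 1 else 0) (dec-true (i ≟ᶠ i) ≡-refl))

  coord-unit-≢ : ∀ {i j} → j ≢ i → coord i (unit j) ≡ 0
  coord-unit-≢ {i} {j} j≢i =
    ≡-trans (coord-fromCoords (δ j) (δ<n j) i)
            (cong (if_then 1 else 0) (dec-false (i ≟ᶠ j) (≢-sym j≢i)))

  coordSum-replicate-++ : ∀ i k x ys → coordSum i (replicate k x ++ ys) ≡ k * coord i x + coordSum i ys
  coordSum-replicate-++ i zero    x ys = ≡-refl
  coordSum-replicate-++ i (suc k) x ys =
    ≡-trans (cong (coord i x +_) (coordSum-replicate-++ i k x ys)) (≡-sym (+-assoc (coord i x) _ _))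

  small-coordinates⇒zeroSumFree : ∀ {S} → All (λ x → ∃ λ i → 1 ≤ coord i x × coordSum i S < n i) S →
                                  ¬ HasNZSS G S
  small-coordinates⇒zeroSumFree witnesses (u ∷ U , U⊆S , _ , σU≈ε) with All-resp-⊆ U⊆S witnesses
  ... | (i , 1≤cu , sum<n) ∷ _ = contradiction 1≤0 λ ()
    where
    open ≤-Reasoning
    sumU<n : coordSum i (u ∷ U) < n i
    sumU<n = ≤-trans (s≤s (sum-mono-⊆ (⊆-map⁺ (coord i) U⊆S))) sum<n
    1≤0 : 1 ≤ 0
    1≤0 = begin
      1                     ≤⟨ 1≤cu ⟩
      coord i u             ≤⟨ m≤m+n _ _ ⟩
      coordSum i (u ∷ U)    ≡⟨ coord-σ i (u ∷ U) sumU<n ⟨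
      coord i (σ G (u ∷ U)) ≡⟨ cong toℕ (φ-cong σU≈ε i) ⟩
      coord i ε             ≡⟨ coord-ε i ⟩
      0                     ∎

  n+2≤D : ∀ {d} → DavenportBound G d → (i a b : Fin r) → a ≢ i → b ≢ i →
          coordSum a (unit a ∷ unit b ∷ []) < n a → coordSum b (unit a ∷ unit b ∷ []) < n b →
          n i + 2 ≤ d
  n+2≤D {d} dav i a b a≢i b≢i a-small b-small =
    subst (λ k → k + 2 ≤ d) (suc-pred (n i))
      (subst (_< d) |S| (zeroSumFree⇒length<D G dav (small-coordinates⇒zeroSumFree witnesses)))
    where
    m : ℕ
    m = pred (n i)
    W S : List C
    W = unit a ∷ unit b ∷ []
    S = replicate m (unit i) ++ W
    |S| : length S ≡ m + 2
    |S| = ≡-trans (length-++ (replicate m (unit i))) (cong (_+ 2) (length-replicate m))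
    coordSum-S : ∀ j → coordSum j S ≡ m * coord j (unit i) + coordSum j W
    coordSum-S j = coordSum-replicate-++ j m (unit i) W
    i-small : coordSum i S < n i
    i-small rewrite coordSum-S i | coord-unit-≡ i | coord-unit-≢ a≢i | coord-unit-≢ b≢i
                  | *-identityʳ m | +-identityʳ m = ≤-reflexive (suc-pred (n i))
    a-small′ : coordSum a S < n a
    a-small′ rewrite coordSum-S a | coord-unit-≢ (≢-sym a≢i) | *-zeroʳ m = a-small
    b-small′ : coordSum b S < n b
    b-small′ rewrite coordSum-S b | coord-unit-≢ (≢-sym b≢i) | *-zeroʳ m = b-small
    witness : ∀ j → coordSum j S < n j → ∃ λ k → 1 ≤ coord k (unit j) × coordSum k S < n k
    witness j small = j , ≤-reflexive (≡-sym (coord-unit-≡ j)) , small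
    witnesses : All (λ x → ∃ λ i → 1 ≤ coord i x × coordSum i S < n i) S
    witnesses = ++⁺ (replicate⁺ m (witness i i-small)) (witness a a-small′ ∷ witness b b-small′ ∷ [])

chain-1< : ∀ {c ℓ} {G : AbelianGroup c ℓ} {r} {ns : Vec ℕ r} → Chain G ns → ∀ i → 1 < lookup ns i
chain-1< (one 1<n)      fz     = 1<n
chain-1< (cons 1<n _ _) fz     = 1<n
chain-1< (cons _ _ ch)  (fs i) = chain-1< ch i

chain-∣-last : ∀ {c ℓ} {G : AbelianGroup c ℓ} {r} {ns : Vec ℕ (suc r)} →
               Chain G ns → ∀ i → lookup ns i ∣ lookup ns (fromℕ r)
chain-∣-last (one _)         fz     = ∣-refl
chain-∣-last (cons _ n∣m ch) fz     = ∣-trans n∣m (chain-∣-last ch fz)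
chain-∣-last (cons _ _ ch)   (fs i) = chain-∣-last ch i

factors⇒IsoC2C2m : ∀ {c ℓ} {G : AbelianGroup c ℓ} {n₀ n₁ q} → n₀ ≡ 2 → n₁ ≡ q * n₀ →
                   IsoCycSum G (n₀ ∷ n₁ ∷ []) → IsoC2C2m G q
factors⇒IsoC2C2m {G = G} {q = q} ≡-refl ≡-refl = subst (λ k → IsoCycSum G (2 ∷ k ∷ [])) (*-comm q 2)

exponent+2≤D : ∀ {c ℓ} {G : AbelianGroup c ℓ} {r} {ns : Vec ℕ (suc (suc r))} →
               Chain G ns → IsoCycSum G ns → (∀ m → 1 ≤ m → ¬ IsoC2C2m G m) →
               ∀ {d} → DavenportBound G d → lookup ns (fromℕ (suc r)) + 2 ≤ d
exponent+2≤D {ns = n₀ ∷ _} chain iso _ dav with 3 ≤? n₀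
... | yes 3≤n₀ = n+2≤D dav (fromℕ _) fz fz (λ ()) (λ ()) small small
  where
  open Coordinates _ iso (chain-1< chain)
  small : coordSum fz (unit fz ∷ unit fz ∷ []) < n fz
  small rewrite coord-unit-≡ fz = 3≤n₀
exponent+2≤D {r = suc r} chain iso _ dav | no _ =
  n+2≤D dav (fromℕ _) fz (fs fz) (λ ()) (λ ()) small₀ small₁
  where
  open Coordinates _ iso (chain-1< chain)
  small₀ : coordSum fz (unit fz ∷ unit (fs fz) ∷ []) < n fz
  small₀ rewrite coord-unit-≡ fz | coord-unit-≢ {fz} {fs fz} (λ ()) = chain-1< chain fz
  small₁ : coordSum (fs fz) (unit fz ∷ unit (fs fz) ∷ []) < n (fs fz)
  small₁ rewrite coord-unit-≢ {fs fz} {fz} (λ ()) | coord-unit-≡ (fs fz) = chain-1< chain (fs fz)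
exponent+2≤D {r = zero} (cons _ (divides zero ≡-refl) (one ())) _ _ _ | no _
exponent+2≤D {r = zero} (cons 1<n₀ (divides (suc q) n₁≡q*n₀) (one _)) iso notC₂⊕C₂ₘ _ | no 3≰n₀ =
  contradiction (factors⇒IsoC2C2m (≤-antisym (≤-pred (≰⇒> 3≰n₀)) 1<n₀) n₁≡q*n₀ iso)
                (notC₂⊕C₂ₘ (suc q) (s≤s z≤n))

-- Finiteness follows from the isomorphism, and only the upper-bound half of IsDavenport is used.
mainTheorem7 : ∀ {c ℓ} (G : AbelianGroup c ℓ) → IsFinite G
    → (r : ℕ) → HasRank G r → 2 ≤ r
    → (∀ (m : ℕ) → 1 ≤ m → ¬ IsoC2C2m G m)
    → (d : ℕ) → IsDavenport G d
    → (T : List (AbelianGroup.Carrier G)) (g : AbelianGroup.Carrier G)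
    → ZeroSum G T → suc (length T) ≡ d
    → Σ (List (AbelianGroup.Carrier G)) λ U → U ⊆ (g ∷ g ∷ T)
         × 1 ≤ length U × length U + 2 ≤ d × ZeroSum G U
mainTheorem7 G _ (suc (suc r)) (ns , chain , iso) (s≤s (s≤s z≤n)) notC₂⊕C₂ₘ d (dav , _) T g σT≈ε |T|+1≡d =
  ShortZeroSums.short-zero-sum G g _≈?_ dav (<⇒≤ (chain-1< chain (fromℕ (suc r))))
    (exponent+2≤D chain iso notC₂⊕C₂ₘ dav) (·-annihilates (chain-∣-last chain) g) σT≈ε |T|+1≡d
  where open Coordinates G iso (chain-1< chain)
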